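{- Let $G=(V,E)$ be a finite simple undirected graph without self-loops in which every vertex has positive degree, let $C$ be a positive integer and $t\ge1$. Suppose that for every $u\in V$, $\Pr[\text{$u$ fails}\mid v_0=u] \le \delta$. Then for any starting vertex $s \in V$, $\Pr[\text{at least one vertex fails}\mid v_0=s]\le t\delta$.
   Context: $d(u)$ denotes the degree. Let $B=\{u\in V: d(u)\ge C+1\}$. Each undirected edge $\{u,v\}$ gives two arcs $(u,v)$ and $(v,u)$; let $E_0$ be the set of arcs $(u,v)$ with $v\in B$. Probabilities are over the $t$-step simple random walk $(v_0,\dots,v_t)$ started at the given vertex (each step moves to a uniformly random neighbor). In a walk $(v_0,\dots,v_t)$, a vertex $u$ fails if $|\{i: v_i=u \text{ and } (v_i,v_{i+1})\in E_0\}|>C$. -}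

module Defs where

open import Data.Nat as ℕ using (ℕ; zero; suc; _<?_; _≤?_)
open import Data.Integer using (+_)
open import Data.Rational using (ℚ; _/_; 0ℚ; 1ℚ; _+_; _*_)
open import Data.Fin using (Fin; _≟_)
open import Data.List using (List; []; _∷_; [_]; map; concatMap; allFin; foldr; filter)
open import Data.Nat.ListAction using (sum)
open import Data.Bool.ListAction using (any)
open import Data.Vec using (Vec; []; _∷_)
open import Data.Bool using (Bool; true; false; if_then_else_; _∧_)
open import Relation.Nullary.Decidable using (⌊_⌋)
open import Relation.Binary.PropositionalEquality using (_≡_)

record Graph (n : ℕ) : Set where
  field
    adj     : Fin n → Fin n → Bool
    symm    : ∀ u v → adj u v ≡ adj v u
    irrefl  : ∀ u → adj u u ≡ false
open Graph public

deg : ∀ {n} → Graph n → Fin n → ℕ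
deg {n} G u = sum (map (λ v → if adj G u v then 1 else 0) (allFin n))

-- 1/k as a rational (0 for k = 0; never used at k = 0 when degrees are positive)
inv : ℕ → ℚ
inv zero    = 0ℚ
inv (suc k) = + 1 / suc k

step : ∀ {n} → Graph n → Fin n → Fin n → ℚ
step G u v = if adj G u v then inv (deg G u) else 0ℚ

seqs : (n k : ℕ) → List (Vec (Fin n) k)
seqs n zero    = [ [] ]
seqs n (suc k) = concatMap (λ v → map (v ∷_) (seqs n k)) (allFin n)

walks : ∀ {n} (t : ℕ) → Fin n → List (Vec (Fin n) (suc t))
walks {n} t s = map (s ∷_) (seqs n t)

weight : ∀ {n k} → Graph n → Vec (Fin n) (suc k) → ℚ
weight G (v ∷ [])         = 1ℚ
weight G (v ∷ w ∷ rest)   = step G v w * weight G (w ∷ rest)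

Pr : ∀ {n} → Graph n → (t : ℕ) → Fin n → (Vec (Fin n) (suc t) → Bool) → ℚ
Pr G t s E = foldr _+_ 0ℚ (map (weight G) (filter (λ w → E w Data.Bool.≟ true) (walks t s)))

-- |{ i : v_i = u and (v_i, v_{i+1}) ∈ E_0 }|, where E_0 = arcs into B = {d ≥ C+1}
failCount : ∀ {n k} → Graph n → (C : ℕ) → Fin n → Vec (Fin n) (suc k) → ℕ
failCount G C u (v ∷ [])       = 0
failCount G C u (v ∷ w ∷ rest) =
  (if ⌊ v ≟ u ⌋ ∧ ⌊ suc C ≤? deg G w ⌋ then 1 else 0) ℕ.+ failCount G C u (w ∷ rest)

fails : ∀ {n k} → Graph n → (C : ℕ) → Fin n → Vec (Fin n) (suc k) → Bool
fails G C u w = ⌊ C <? failCount G C u w ⌋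

someFails : ∀ {n k} → Graph n → (C : ℕ) → Vec (Fin n) (suc k) → Bool
someFails {n} G C w = any (λ u → fails G C u w) (allFin n)

-- A walk from s in which some vertex fails either makes s itself fail, or (since dropping
-- the first step removes only arcs leaving s) has a vertex failing in its tail, a walk from
-- the next vertex with one step fewer.  Failing is preserved by extending a walk and the first
-- k + 1 vertices of a longer walk are distributed as a k-step walk, so the first event has
-- probability at most Pr[s fails within t steps] ≤ δ; by induction on the length the second
-- has probability at most (k − 1)δ after averaging over the first step.
module Submission where

open import Defs
open import Data.Nat using (ℕ; _≥_; _>_)
open import Data.Fin using (Fin; _≟_)
open import Data.Integer using (+_)
open import Data.Rational using (ℚ; _≤_; _*_; _/_)

open import Algebra.Bundles using (CommutativeMonoid)
import Algebra.Properties.CommutativeSemigroup as CommutativeSemigroupProperties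
open import Data.Bool using (Bool; true; false; T; if_then_else_; _∧_)
open import Data.Empty using (⊥-elim)
import Data.Integer as ℤ
import Data.Integer.Properties as ℤ
open import Data.List using (List; []; _∷_; map; concatMap; foldr; filter; _++_; allFin)
open import Data.List.Membership.Propositional using (lose)
open import Data.List.Membership.Propositional.Properties using (∈-allFin)
open import Data.List.Relation.Unary.Any using (satisfied)
open import Data.List.Relation.Unary.Any.Properties using (any⁺; any⁻)
open import Data.Nat as ℕ using (zero; suc)
open import Data.Nat.ListAction using (sum)
import Data.Nat.Coprimality as Coprime
import Data.Nat.Properties as ℕ
open import Data.Product using (_,_; proj₂)
open import Data.Rational using (0ℚ; 1ℚ; _+_; mkℚ; toℚᵘ; nonNegative)
open import Data.Rational.Properties
  using ( ≤-refl; ≤-trans; module ≤-Reasoning; +-mono-≤; +-monoˡ-≤; +-monoʳ-≤; *-monoˡ-≤-nonNeg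
        ; +-assoc; +-comm; +-identityˡ; +-identityʳ; +-0-commutativeMonoid
        ; *-assoc; *-identityˡ; *-identityʳ; *-zeroˡ; *-zeroʳ; *-distribˡ-+; *-distribʳ-+; *-inverseʳ
        ; nonNegative⁻¹; nonNeg*nonNeg⇒nonNeg; normalize-nonNeg; normalize-coprime
        ; toℚᵘ-injective; toℚᵘ-fromℚᵘ; toℚᵘ-homo-+ )
import Data.Rational.Unnormalised as ℚᵘ
import Data.Rational.Unnormalised.Properties as ℚᵘ
open import Data.Sum using (_⊎_; inj₁; inj₂)
open import Data.Vec using (Vec; []; _∷_; init)
open import Function using (_∘_)
open import Relation.Binary.PropositionalEquality
open import Relation.Nullary using (¬_; Dec; yes; no; contradiction)
open import Relation.Nullary.Decidable using (⌊_⌋; toWitness; fromWitness)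

toℚ : ℕ → ℚ
toℚ k = + k / 1

-- `+ k / 1` normalises through a gcd that does not compute for variable k, hence the detour via ℚᵘ.
toℚ-suc : ∀ k → toℚ (suc k) ≡ 1ℚ + toℚ k
toℚ-suc k = toℚᵘ-injective (begin
  toℚᵘ (toℚ (suc k))                  ≈⟨ toℚᵘ-fromℚᵘ (+ suc k ℚᵘ./ 1) ⟩
  + suc k ℚᵘ./ 1                      ≈⟨ ℚᵘ.*≡* (cong (ℤ._* + 1) (sym numerator)) ⟩
  ℚᵘ.1ℚᵘ ℚᵘ.+ (+ k ℚᵘ./ 1)            ≈⟨ ℚᵘ.+-congʳ ℚᵘ.1ℚᵘ (ℚᵘ.≃-sym (toℚᵘ-fromℚᵘ (+ k ℚᵘ./ 1))) ⟩
  toℚᵘ 1ℚ ℚᵘ.+ toℚᵘ (toℚ k)           ≈⟨ ℚᵘ.≃-sym (toℚᵘ-homo-+ 1ℚ (toℚ k)) ⟩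
  toℚᵘ (1ℚ + toℚ k)                   ∎)
  where
  open ℚᵘ.≃-Reasoning
  numerator : + 1 ℤ.+ + k ℤ.* + 1 ≡ + suc k
  numerator = cong (ℤ._+_ (+ 1)) (ℤ.*-identityʳ (+ k))

toℚ*inv : ∀ {d} → d > 0 → toℚ d * inv d ≡ 1ℚ
toℚ*inv {suc m} _ rewrite normalize-coprime {suc m} {0} (Coprime.sym (Coprime.1-coprimeTo (suc m)))
                        | normalize-coprime {1} {m} (Coprime.1-coprimeTo (suc m))
  = *-inverseʳ (mkℚ (+ suc m) 0 (Coprime.sym (Coprime.1-coprimeTo (suc m))))

0≤inv : ∀ k → 0ℚ ≤ inv k
0≤inv zero    = ≤-refl
0≤inv (suc m) = nonNegative⁻¹ (inv (suc m)) {{normalize-nonNeg 1 (suc m)}}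

0≤1 : 0ℚ ≤ 1ℚ
0≤1 = nonNegative⁻¹ 1ℚ

0≤+ : ∀ {p q} → 0ℚ ≤ p → 0ℚ ≤ q → 0ℚ ≤ p + q
0≤+ 0≤p 0≤q = +-mono-≤ 0≤p 0≤q

0≤* : ∀ {p q} → 0ℚ ≤ p → 0ℚ ≤ q → 0ℚ ≤ p * q
0≤* {p} {q} 0≤p 0≤q = nonNegative⁻¹ (p * q)
  {{nonNeg*nonNeg⇒nonNeg p {{nonNegative 0≤p}} q {{nonNegative 0≤q}}}}

*-monoˡ-≤-0≤ : ∀ {r p q} → 0ℚ ≤ r → p ≤ q → r * p ≤ r * q
*-monoˡ-≤-0≤ {r} 0≤r = *-monoˡ-≤-nonNeg r {{nonNegative 0≤r}}

p≤p+q : ∀ {p q} → 0ℚ ≤ q → p ≤ p + q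
p≤p+q {p} 0≤q = subst (_≤ p + _) (+-identityʳ p) (+-monoʳ-≤ p 0≤q)

p≤q+p : ∀ {p q} → 0ℚ ≤ q → p ≤ q + p
p≤q+p {p} {q} 0≤q = subst (p ≤_) (+-comm p q) (p≤p+q 0≤q)

𝟙 : Bool → ℚ
𝟙 b = if b then 1ℚ else 0ℚ

0≤𝟙 : ∀ b → 0ℚ ≤ 𝟙 b
0≤𝟙 true  = 0≤1
0≤𝟙 false = ≤-refl

𝟙-mono : ∀ {a b} → (T a → T b) → 𝟙 a ≤ 𝟙 b
𝟙-mono {false} {b}    _   = 0≤𝟙 b
𝟙-mono {true}  {true} _   = ≤-refl
𝟙-mono {true}  {false} a⇒b = ⊥-elim (a⇒b _)

𝟙-union : ∀ {a b c} → (T a → T b ⊎ T c) → 𝟙 a ≤ 𝟙 b + 𝟙 c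
𝟙-union {false} {b} {c} _ = 0≤+ (0≤𝟙 b) (0≤𝟙 c)
𝟙-union {true}  {b} {c} a⇒b∨c with a⇒b∨c _
𝟙-union {true} {true}  {c} _ | inj₁ _ = p≤p+q (0≤𝟙 c)
𝟙-union {true} {b} {true}  _ | inj₂ _ = p≤q+p (0≤𝟙 b)

open CommutativeSemigroupProperties (CommutativeMonoid.commutativeSemigroup +-0-commutativeMonoid)
  using () renaming (interchange to +-interchange)

∑ : {A : Set} → List A → (A → ℚ) → ℚ
∑ xs f = foldr _+_ 0ℚ (map f xs)

module _ {A : Set} where

  ∑-cong : ∀ xs {f g : A → ℚ} → (∀ x → f x ≡ g x) → ∑ xs f ≡ ∑ xs g
  ∑-cong []       f≗g = refl
  ∑-cong (x ∷ xs) f≗g = cong₂ _+_ (f≗g x) (∑-cong xs f≗g)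

  ∑-mono : ∀ xs {f g : A → ℚ} → (∀ x → f x ≤ g x) → ∑ xs f ≤ ∑ xs g
  ∑-mono []       f≤g = ≤-refl
  ∑-mono (x ∷ xs) f≤g = +-mono-≤ (f≤g x) (∑-mono xs f≤g)

  ∑-++ : ∀ xs ys (f : A → ℚ) → ∑ (xs ++ ys) f ≡ ∑ xs f + ∑ ys f
  ∑-++ []       ys f = sym (+-identityˡ _)
  ∑-++ (x ∷ xs) ys f = trans (cong (_+_ (f x)) (∑-++ xs ys f)) (sym (+-assoc (f x) _ _))

  ∑-*ˡ : ∀ xs c (f : A → ℚ) → ∑ xs (λ x → c * f x) ≡ c * ∑ xs f
  ∑-*ˡ []       c f = sym (*-zeroʳ c)
  ∑-*ˡ (x ∷ xs) c f = trans (cong (_+_ (c * f x)) (∑-*ˡ xs c f)) (sym (*-distribˡ-+ c (f x) _))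

  ∑-*ʳ : ∀ xs c (f : A → ℚ) → ∑ xs (λ x → f x * c) ≡ ∑ xs f * c
  ∑-*ʳ []       c f = sym (*-zeroˡ c)
  ∑-*ʳ (x ∷ xs) c f = trans (cong (_+_ (f x * c)) (∑-*ʳ xs c f)) (sym (*-distribʳ-+ c (f x) _))

  ∑-+ : ∀ xs (f g : A → ℚ) → ∑ xs (λ x → f x + g x) ≡ ∑ xs f + ∑ xs g
  ∑-+ []       f g = sym (+-identityˡ 0ℚ)
  ∑-+ (x ∷ xs) f g = trans (cong (_+_ (f x + g x)) (∑-+ xs f g)) (+-interchange (f x) (g x) _ _)

  ∑-count : ∀ xs (p : A → Bool) c →
    ∑ xs (λ x → if p x then c else 0ℚ) ≡ toℚ (sum (map (λ x → if p x then 1 else 0) xs)) * c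
  ∑-count []       p c = sym (*-zeroˡ c)
  ∑-count (x ∷ xs) p c with p x
  ... | false = trans (+-identityˡ _) (∑-count xs p c)
  ... | true  = begin
    c + ∑ xs (λ x → if p x then c else 0ℚ)  ≡⟨ cong (_+_ c) (∑-count xs p c) ⟩
    c + toℚ m * c                            ≡⟨ cong (_+ toℚ m * c) (sym (*-identityˡ c)) ⟩
    1ℚ * c + toℚ m * c                       ≡⟨ sym (*-distribʳ-+ c 1ℚ (toℚ m)) ⟩
    (1ℚ + toℚ m) * c                         ≡⟨ cong (_* c) (sym (toℚ-suc m)) ⟩
    toℚ (suc m) * c                          ∎
    where
    open ≡-Reasoning
    m = sum (map (λ x → if p x then 1 else 0) xs)

  ∑-filter : ∀ xs (E : A → Bool) (f : A → ℚ) →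
    ∑ (filter (λ x → E x Data.Bool.≟ true) xs) f ≡ ∑ xs (λ x → f x * 𝟙 (E x))
  ∑-filter []       E f = refl
  ∑-filter (x ∷ xs) E f with E x
  ... | true  = cong₂ _+_ (sym (*-identityʳ (f x))) (∑-filter xs E f)
  ... | false = begin
    ∑ (filter (λ x → E x Data.Bool.≟ true) xs) f ≡⟨ ∑-filter xs E f ⟩
    ∑ xs (λ x → f x * 𝟙 (E x))                   ≡⟨ sym (+-identityˡ _) ⟩
    0ℚ + ∑ xs (λ x → f x * 𝟙 (E x))              ≡⟨ cong (_+ _) (sym (*-zeroʳ (f x))) ⟩
    f x * 0ℚ + ∑ xs (λ x → f x * 𝟙 (E x))        ∎
    where open ≡-Reasoning

module _ {A B : Set} where

  ∑-map : ∀ xs (g : A → B) (f : B → ℚ) → ∑ (map g xs) f ≡ ∑ xs (λ x → f (g x))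
  ∑-map []       g f = refl
  ∑-map (x ∷ xs) g f = cong (_+_ (f (g x))) (∑-map xs g f)

  ∑-concatMap : ∀ xs (h : A → List B) (f : B → ℚ) → ∑ (concatMap h xs) f ≡ ∑ xs (λ x → ∑ (h x) f)
  ∑-concatMap []       h f = refl
  ∑-concatMap (x ∷ xs) h f = trans (∑-++ (h x) (concatMap h xs) f) (cong (_+_ (∑ (h x) f)) (∑-concatMap xs h f))

Walk : ℕ → ℕ → Set
Walk n k = Vec (Fin n) (suc k)

module RandomWalk {n : ℕ} (G : Graph n) where

  𝔼 : (k : ℕ) → Fin n → (Walk n k → ℚ) → ℚ
  𝔼 k s f = ∑ (walks k s) (λ w → weight G w * f w)

  0≤step : ∀ u v → 0ℚ ≤ step G u v
  0≤step u v with adj G u v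
  ... | true  = 0≤inv (deg G u)
  ... | false = ≤-refl

  0≤weight : ∀ {k} (w : Walk n k) → 0ℚ ≤ weight G w
  0≤weight (v ∷ [])         = 0≤1
  0≤weight (u ∷ v ∷ rest)   = 0≤* (0≤step u v) (0≤weight (v ∷ rest))

  Pr≡𝔼 : ∀ k s (E : Walk n k → Bool) → Pr G k s E ≡ 𝔼 k s (𝟙 ∘ E)
  Pr≡𝔼 k s E = ∑-filter (walks k s) E (weight G)

  𝔼-mono : ∀ k s {f g : Walk n k → ℚ} → (∀ w → f w ≤ g w) → 𝔼 k s f ≤ 𝔼 k s g
  𝔼-mono k s f≤g = ∑-mono (walks k s) (λ w → *-monoˡ-≤-0≤ (0≤weight w) (f≤g w))

  𝔼-+ : ∀ k s (f g : Walk n k → ℚ) → 𝔼 k s (λ w → f w + g w) ≡ 𝔼 k s f + 𝔼 k s g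
  𝔼-+ k s f g = trans (∑-cong (walks k s) (λ w → *-distribˡ-+ (weight G w) (f w) (g w)))
                      (∑-+ (walks k s) _ _)

  𝔼-zero : ∀ s (f : Walk n 0 → ℚ) → 𝔼 0 s f ≡ f (s ∷ [])
  𝔼-zero s f = trans (+-identityʳ _) (*-identityˡ _)

  𝔼-suc : ∀ k s (f : Walk n (suc k) → ℚ) →
    𝔼 (suc k) s f ≡ ∑ (allFin n) (λ v → step G s v * 𝔼 k v (f ∘ (s ∷_)))
  𝔼-suc k s f = begin
    𝔼 (suc k) s f
      ≡⟨ ∑-map (concatMap paths (allFin n)) (s ∷_) _ ⟩
    ∑ (concatMap paths (allFin n)) (λ r → weight G (s ∷ r) * f (s ∷ r))
      ≡⟨ ∑-concatMap (allFin n) paths _ ⟩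
    ∑ (allFin n) (λ v → ∑ (paths v) (λ r → weight G (s ∷ r) * f (s ∷ r)))
      ≡⟨ ∑-cong (allFin n) firstStep ⟩
    ∑ (allFin n) (λ v → step G s v * 𝔼 k v (f ∘ (s ∷_)))  ∎
    where
    open ≡-Reasoning
    paths : Fin n → List (Walk n k)
    paths v = map (v ∷_) (seqs n k)
    firstStep : ∀ v → ∑ (paths v) (λ r → weight G (s ∷ r) * f (s ∷ r)) ≡ step G s v * 𝔼 k v (f ∘ (s ∷_))
    firstStep v = begin
      ∑ (paths v) (λ r → weight G (s ∷ r) * f (s ∷ r))
        ≡⟨ ∑-map (seqs n k) (v ∷_) _ ⟩
      ∑ (seqs n k) (λ r → step G s v * weight G (v ∷ r) * f (s ∷ v ∷ r))
        ≡⟨ ∑-cong (seqs n k) (λ r → *-assoc (step G s v) (weight G (v ∷ r)) (f (s ∷ v ∷ r))) ⟩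
      ∑ (seqs n k) (λ r → step G s v * (weight G (v ∷ r) * f (s ∷ v ∷ r)))
        ≡⟨ ∑-*ˡ (seqs n k) (step G s v) _ ⟩
      step G s v * ∑ (seqs n k) (λ r → weight G (v ∷ r) * f (s ∷ v ∷ r))
        ≡⟨ cong (step G s v *_) (sym (∑-map (seqs n k) (v ∷_) _)) ⟩
      step G s v * 𝔼 k v (f ∘ (s ∷_))  ∎

  module Stochastic (deg>0 : ∀ u → deg G u > 0) where

    ∑-step≡1 : ∀ u → ∑ (allFin n) (step G u) ≡ 1ℚ
    ∑-step≡1 u = trans (∑-count (allFin n) (adj G u) (inv (deg G u))) (toℚ*inv (deg>0 u))

    ∑-step-≤ : ∀ u {x : Fin n → ℚ} {c} → (∀ v → x v ≤ c) → ∑ (allFin n) (λ v → step G u v * x v) ≤ c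
    ∑-step-≤ u {x} {c} x≤c = begin
      ∑ (allFin n) (λ v → step G u v * x v) ≤⟨ ∑-mono (allFin n) (λ v → *-monoˡ-≤-0≤ (0≤step u v) (x≤c v)) ⟩
      ∑ (allFin n) (λ v → step G u v * c)   ≡⟨ ∑-*ʳ (allFin n) c (step G u) ⟩
      ∑ (allFin n) (step G u) * c           ≡⟨ cong (_* c) (∑-step≡1 u) ⟩
      1ℚ * c                                ≡⟨ *-identityˡ c ⟩
      c                                     ∎
      where open ≤-Reasoning

    𝔼-init : ∀ k s (f : Walk n k → ℚ) → 𝔼 (suc k) s (f ∘ init) ≡ 𝔼 k s f
    𝔼-init zero s f = begin
      𝔼 1 s (f ∘ init)                                   ≡⟨ 𝔼-suc 0 s (f ∘ init) ⟩
      ∑ (allFin n) (λ v → step G s v * 𝔼 0 v (λ _ → c))  ≡⟨ ∑-cong (allFin n) (λ v → cong (step G s v *_) (𝔼-zero v (λ _ → c))) ⟩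
      ∑ (allFin n) (λ v → step G s v * c)                ≡⟨ ∑-*ʳ (allFin n) c (step G s) ⟩
      ∑ (allFin n) (step G s) * c                        ≡⟨ cong (_* c) (∑-step≡1 s) ⟩
      1ℚ * c                                             ≡⟨ *-identityˡ c ⟩
      c                                                  ≡⟨ sym (𝔼-zero s f) ⟩
      𝔼 0 s f                                            ∎
      where
      open ≡-Reasoning
      c = f (s ∷ [])
    𝔼-init (suc k) s f = begin
      𝔼 (suc (suc k)) s (f ∘ init)                             ≡⟨ 𝔼-suc (suc k) s (f ∘ init) ⟩
      ∑ (allFin n) (λ v → step G s v * 𝔼 (suc k) v (f ∘ (s ∷_) ∘ init))
        ≡⟨ ∑-cong (allFin n) (λ v → cong (step G s v *_) (𝔼-init k v (f ∘ (s ∷_)))) ⟩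
      ∑ (allFin n) (λ v → step G s v * 𝔼 k v (f ∘ (s ∷_)))     ≡⟨ sym (𝔼-suc k s f) ⟩
      𝔼 (suc k) s f                                            ∎
      where open ≡-Reasoning

    𝔼-mono-length : ∀ s (f : ∀ {k} → Walk n k → ℚ) → (∀ {k} (w : Walk n (suc k)) → f (init w) ≤ f w) →
      ∀ {j k} → j ℕ.≤ k → 𝔼 j s f ≤ 𝔼 k s f
    𝔼-mono-length s f f-init≤f j≤k = go (ℕ.≤⇒≤′ j≤k)
      where
      go : ∀ {j k} → j ℕ.≤′ k → 𝔼 j s f ≤ 𝔼 k s f
      go ℕ.≤′-refl             = ≤-refl
      go {j} (ℕ.≤′-step {k} j≤′k) = begin
        𝔼 j s f             ≤⟨ go j≤′k ⟩
        𝔼 k s f             ≡⟨ sym (𝔼-init k s f) ⟩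
        𝔼 (suc k) s (f ∘ init) ≤⟨ 𝔼-mono (suc k) s f-init≤f ⟩
        𝔼 (suc k) s f       ∎
        where open ≤-Reasoning

    𝔼-first-step-≤ : ∀ k s {f g : Walk n (suc k) → ℚ} {h : Walk n k → ℚ} {c} →
      (∀ w → f (s ∷ w) ≤ g (s ∷ w) + h w) → (∀ v → 𝔼 k v h ≤ c) → 𝔼 (suc k) s f ≤ 𝔼 (suc k) s g + c
    𝔼-first-step-≤ k s {f} {g} {h} {c} f≤g+h 𝔼h≤c = begin
      𝔼 (suc k) s f
        ≡⟨ 𝔼-suc k s f ⟩
      ∑ (allFin n) (λ v → step G s v * 𝔼 k v (f ∘ (s ∷_)))
        ≤⟨ ∑-mono (allFin n) (λ v → *-monoˡ-≤-0≤ (0≤step s v) (𝔼-mono k v f≤g+h)) ⟩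
      ∑ (allFin n) (λ v → step G s v * 𝔼 k v (λ w → g (s ∷ w) + h w))
        ≡⟨ ∑-cong (allFin n) (λ v → trans (cong (step G s v *_) (𝔼-+ k v (g ∘ (s ∷_)) h))
                                           (*-distribˡ-+ (step G s v) _ _)) ⟩
      ∑ (allFin n) (λ v → step G s v * 𝔼 k v (g ∘ (s ∷_)) + step G s v * 𝔼 k v h)
        ≡⟨ ∑-+ (allFin n) _ _ ⟩
      ∑ (allFin n) (λ v → step G s v * 𝔼 k v (g ∘ (s ∷_))) + ∑ (allFin n) (λ v → step G s v * 𝔼 k v h)
        ≡⟨ cong (_+ _) (sym (𝔼-suc k s g)) ⟩
      𝔼 (suc k) s g + ∑ (allFin n) (λ v → step G s v * 𝔼 k v h)
        ≤⟨ +-monoʳ-≤ (𝔼 (suc k) s g) (∑-step-≤ s 𝔼h≤c) ⟩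
      𝔼 (suc k) s g + c  ∎
      where open ≤-Reasoning

module Failures {n : ℕ} (G : Graph n) (C : ℕ) where

  failCount-init : ∀ {k} u (w : Walk n (suc k)) → failCount G C u (init w) ℕ.≤ failCount G C u w
  failCount-init {zero}  u (x ∷ y ∷ [])    = ℕ.z≤n
  failCount-init {suc k} u (x ∷ y ∷ z ∷ r) =
    ℕ.+-monoʳ-≤ (if ⌊ x ≟ u ⌋ ∧ ⌊ suc C ℕ.≤? deg G y ⌋ then 1 else 0) (failCount-init u (y ∷ z ∷ r))

  fails-init : ∀ {k} u (w : Walk n (suc k)) → T (fails G C u (init w)) → T (fails G C u w)
  fails-init u w failed = fromWitness (ℕ.<-≤-trans (toWitness failed) (failCount-init u w))

  failCount-cons-≢ : ∀ {k u x} y (r : Vec (Fin n) k) → x ≢ u → failCount G C u (x ∷ y ∷ r) ≡ failCount G C u (y ∷ r)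
  failCount-cons-≢ {u = u} {x} y r x≢u with x ≟ u
  ... | yes x≡u = contradiction x≡u x≢u
  ... | no  _   = refl

  ¬someFails-[] : ∀ s → ¬ T (someFails G C (s ∷ []))
  ¬someFails-[] s someFailed = proj₂ (satisfied (any⁻ _ (allFin n) someFailed))

  someFails-cons : ∀ {k} x (w : Walk n k) →
    T (someFails G C (x ∷ w)) → T (fails G C x (x ∷ w)) ⊎ T (someFails G C w)
  someFails-cons x w@(y ∷ r) someFailed with satisfied (any⁻ _ (allFin n) someFailed)
  ... | u , u-fails = split (x ≟ u)
    where
    split : Dec (x ≡ u) → T (fails G C x (x ∷ w)) ⊎ T (someFails G C w)
    split (yes refl) = inj₁ u-fails
    split (no x≢u)   = inj₂ (any⁺ _ (lose (∈-allFin u)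
                          (subst (λ m → T ⌊ C ℕ.<? m ⌋) (failCount-cons-≢ y r x≢u) u-fails)))

module _ {n : ℕ} (G : Graph n) (deg>0 : ∀ u → deg G u > 0) (C : ℕ) where
  open RandomWalk G
  open Stochastic deg>0
  open Failures G C

  someFails-bound : ∀ {t δ} → (∀ u → 𝔼 t u (𝟙 ∘ fails G C u) ≤ δ) →
    ∀ {k} → k ℕ.≤ t → ∀ s → 𝔼 k s (𝟙 ∘ someFails G C) ≤ toℚ k * δ
  someFails-bound {t} {δ} fail≤δ {zero} _ s = begin
    𝔼 0 s (𝟙 ∘ someFails G C)  ≡⟨ 𝔼-zero s (𝟙 ∘ someFails G C) ⟩
    𝟙 (someFails G C (s ∷ [])) ≤⟨ 𝟙-mono (¬someFails-[] s) ⟩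
    0ℚ                         ≡⟨ sym (*-zeroˡ δ) ⟩
    toℚ 0 * δ                  ∎
    where open ≤-Reasoning
  someFails-bound {t} {δ} fail≤δ {suc k} k<t s = begin
    𝔼 (suc k) s (𝟙 ∘ someFails G C)
      ≤⟨ 𝔼-first-step-≤ k s (λ w → 𝟙-union (someFails-cons s w))
                           (someFails-bound {t} fail≤δ (ℕ.<⇒≤ k<t)) ⟩
    𝔼 (suc k) s (𝟙 ∘ fails G C s) + toℚ k * δ
      ≤⟨ +-monoˡ-≤ (toℚ k * δ) s-fails≤δ ⟩
    δ + toℚ k * δ
      ≡⟨ cong (_+ toℚ k * δ) (sym (*-identityˡ δ)) ⟩
    1ℚ * δ + toℚ k * δ
      ≡⟨ sym (*-distribʳ-+ δ 1ℚ (toℚ k)) ⟩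
    (1ℚ + toℚ k) * δ
      ≡⟨ cong (_* δ) (sym (toℚ-suc k)) ⟩
    toℚ (suc k) * δ  ∎
    where
    open ≤-Reasoning
    s-fails≤δ : 𝔼 (suc k) s (𝟙 ∘ fails G C s) ≤ δ
    s-fails≤δ = ≤-trans (𝔼-mono-length s (𝟙 ∘ fails G C s) (𝟙-mono ∘ fails-init s) k<t) (fail≤δ s)

mainTheorem8 : (n : ℕ) (G : Graph n) → (∀ u → deg G u > 0) →
    (C : ℕ) → C ≥ 1 → (t : ℕ) → t ≥ 1 → (δ : ℚ) →
    (∀ u → Pr G t u (fails G C u) ≤ δ) →
    ∀ s → Pr G t s (someFails G C) ≤ (+ t / 1) * δ
mainTheorem8 n G deg>0 C _ t _ δ fail≤δ s = begin
  Pr G t s (someFails G C)        ≡⟨ Pr≡𝔼 t s (someFails G C) ⟩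
  𝔼 t s (𝟙 ∘ someFails G C)       ≤⟨ someFails-bound G deg>0 C {t} fail𝔼≤δ {t} ℕ.≤-refl s ⟩
  toℚ t * δ                       ∎
  where
  open RandomWalk G
  open ≤-Reasoning
  fail𝔼≤δ : ∀ u → 𝔼 t u (𝟙 ∘ fails G C u) ≤ δ
  fail𝔼≤δ u = subst (_≤ δ) (Pr≡𝔼 t u (fails G C u)) (fail≤δ u)
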